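{- Let $p$ be an odd prime, $n$ an odd positive integer with $\gcd(n,p)=1$, and $u$ a primitive $n$-th root of unity over $\mathbb{F}_p$. For integers $r,t$ define $\lambda_j^{(r,t)}=u^{(n-r)j}-u^{(n-t)j}$ for $j=0,\ldots,n-1$. Let $r,t$ and $v,w$ be pairs of integers with $\gcd(n,r+t)=\gcd(n,r-t)=1$ and $\gcd(n,v+w)=\gcd(n,v-w)=1$. Then \[ \prod_{j=1}^{n-1}\lambda_j^{(r,t)}=\prod_{j=1}^{n-1}\lambda_j^{(v,w)}. \] -}

module Defs where

open import Level using (_⊔_)
open import Data.Nat as ℕ using (ℕ; zero; suc; _<_; NonZero)
open import Data.Integer as ℤ using (ℤ; +_; _%ℕ_)
open import Data.Product using (∃)
open import Relation.Nullary using (¬_)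
open import Algebra.Bundles using (CommutativeRing; Semiring)
import Algebra.Definitions.RawSemiring as RS

module _ {c ℓ} (R : CommutativeRing c ℓ) where
  open CommutativeRing R
  open RS (Semiring.rawSemiring semiring) using (_^_; _×_)

  record IsField : Set (c ⊔ ℓ) where
    field
      1≉0     : ¬ (1# ≈ 0#)
      inverse : ∀ x → ¬ (x ≈ 0#) → ∃ λ y → (x * y) ≈ 1#

  HasCharacteristic : ℕ → Set ℓ
  HasCharacteristic p = (p × 1#) ≈ 0#

  record IsPrimitiveRoot (n : ℕ) (u : Carrier) : Set ℓ where
    field
      pow-n≈1   : (u ^ n) ≈ 1#
      pow-k≉1   : ∀ k → 0 < k → k < n → ¬ ((u ^ k) ≈ 1#)

  -- u^k for an integer exponent k, for an n-th root of unity u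
  -- (well defined since u^n = 1): u^k := u^(k mod n)
  powℤ : (n : ℕ) .{{_ : NonZero n}} → Carrier → ℤ → Carrier
  powℤ n u k = u ^ (k %ℕ n)

  lam : (n : ℕ) .{{_ : NonZero n}} → Carrier → ℤ → ℤ → ℕ → Carrier
  lam n u r t j =
    powℤ n u ((+ n ℤ.- r) ℤ.* + j) - powℤ n u ((+ n ℤ.- t) ℤ.* + j)

  prod1 : (ℕ → Carrier) → ℕ → Carrier
  prod1 f zero    = 1#
  prod1 f (suc m) = prod1 f m * f (suc m)

module Submission where

open import Defs
open import Data.Nat as ℕ using (ℕ; NonZero; _%_; _∸_)
open import Data.Nat.GCD using (gcd)
open import Data.Nat.Primality using (Prime)
open import Data.Integer as ℤ using (ℤ; +_)
import Data.Integer.GCD as ℤG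
open import Relation.Binary.PropositionalEquality using (_≡_)
open import Algebra.Bundles using (CommutativeRing)

open import Data.Nat using (zero; suc)
import Data.Nat.Properties as ℕP
open import Data.Nat.DivMod using (_/_; m≡m%n+[m/n]*n; m%n<n; m<n⇒m%n≡m; [m+n]%n≡m%n; [m+kn]%n≡m%n)
open import Data.Nat.GCD using (module Bézout)
open import Data.Nat.Coprimality using (gcd≡1⇒coprime; coprime-Bézout)
import Data.Integer.Properties as ℤP
open import Data.Integer.DivMod using (a≡a%ℕn+[a/ℕn]*n)
open import Data.Integer.Tactic.RingSolver using (solve-∀)
import Data.Nat.Tactic.RingSolver as ℕSolver
open import Data.Fin using (Fin; toℕ; fromℕ<)
import Data.Fin.Properties as FinP
open import Data.Fin.Permutation using (Permutation; permutation)
open import Data.Product using (∃; _,_; proj₁; proj₂)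
open import Relation.Nullary using (¬_; contradiction)
open import Relation.Binary.Bundles using (Setoid)
open import Relation.Binary.Structures using (IsEquivalence)
open import Relation.Binary.PropositionalEquality as ≡ using (cong)
import Relation.Binary.Reasoning.Setoid as SetoidReasoning
import Algebra.Properties.Semiring.Exp as ExpProperties
import Algebra.Properties.Ring as RingProperties
import Algebra.Properties.CommutativeSemigroup as CommutativeSemigroupProperties
import Algebra.Properties.CommutativeMonoid.Sum as ProductProperties

-- Proof idea.  Write n = 2k + 1, B = (n - r) mod n and D = (r - t) mod n.
-- Since n - t = (n - r) + (r - t), every factor splits as
--     λ_j = u^{Bj} - u^{Bj} u^{Dj} = u^{Bj} (1 - u^{Dj}).
-- The first factors multiply to u^{B n(n-1)/2} = u^{Bkn} = 1 (n is odd),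
-- and, as gcd(n, r - t) = 1, the map j ↦ Dj mod n permutes the nonzero
-- residues, so the second factors multiply to ∏_{k=1}^{n-1} (1 - u^k).
-- Hence every admissible pair (r, t) gives the same product, and the
-- theorem compares two instances.  Only u^n = 1, n odd and
-- gcd(n, r - t) = 1 are used.

module Congruence (n : ℕ) where

  infix 4 _≡ₘ_

  record _≡ₘ_ (x y : ℤ) : Set where
    constructor _,_
    field
      quotient : ℤ
      equation : x ≡ y ℤ.+ quotient ℤ.* + n

  ≡ₘ-refl : ∀ {x} → x ≡ₘ x
  ≡ₘ-refl {x} = ℤ.0ℤ , identity x (+ n)
    where
    identity : ∀ x m → x ≡ x ℤ.+ ℤ.0ℤ ℤ.* m
    identity = solve-∀

  ≡ₘ-sym : ∀ {x y} → x ≡ₘ y → y ≡ₘ x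
  ≡ₘ-sym {y = y} (k , x≡y+kn) =
    ℤ.- k , ≡.trans (identity y k (+ n)) (cong (λ z → z ℤ.+ ℤ.- k ℤ.* + n) (≡.sym x≡y+kn))
    where
    identity : ∀ y k m → y ≡ (y ℤ.+ k ℤ.* m) ℤ.+ (ℤ.- k) ℤ.* m
    identity = solve-∀

  ≡ₘ-trans : ∀ {x y z} → x ≡ₘ y → y ≡ₘ z → x ≡ₘ z
  ≡ₘ-trans {z = z} (k , ≡.refl) (l , ≡.refl) = k ℤ.+ l , identity z k l (+ n)
    where
    identity : ∀ z k l m → (z ℤ.+ l ℤ.* m) ℤ.+ k ℤ.* m ≡ z ℤ.+ (k ℤ.+ l) ℤ.* m
    identity = solve-∀

  ≡ₘ-+ : ∀ {x x′ y y′} → x ≡ₘ x′ → y ≡ₘ y′ → x ℤ.+ y ≡ₘ x′ ℤ.+ y′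
  ≡ₘ-+ {x′ = x′} {y′ = y′} (k , ≡.refl) (l , ≡.refl) =
    k ℤ.+ l , identity x′ y′ k l (+ n)
    where
    identity : ∀ x y k l m →
               (x ℤ.+ k ℤ.* m) ℤ.+ (y ℤ.+ l ℤ.* m) ≡ (x ℤ.+ y) ℤ.+ (k ℤ.+ l) ℤ.* m
    identity = solve-∀

  ≡ₘ-* : ∀ {x x′ y y′} → x ≡ₘ x′ → y ≡ₘ y′ → x ℤ.* y ≡ₘ x′ ℤ.* y′
  ≡ₘ-* {x′ = x′} {y′ = y′} (k , ≡.refl) (l , ≡.refl) =
    k ℤ.* y′ ℤ.+ x′ ℤ.* l ℤ.+ k ℤ.* l ℤ.* + n , identity x′ y′ k l (+ n)
    where
    identity : ∀ x y k l m →
               (x ℤ.+ k ℤ.* m) ℤ.* (y ℤ.+ l ℤ.* m)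
                 ≡ x ℤ.* y ℤ.+ (k ℤ.* y ℤ.+ x ℤ.* l ℤ.+ k ℤ.* l ℤ.* m) ℤ.* m
    identity = solve-∀

  ≡ₘ-isEquivalence : IsEquivalence _≡ₘ_
  ≡ₘ-isEquivalence = record { refl = ≡ₘ-refl ; sym = ≡ₘ-sym ; trans = ≡ₘ-trans }

  ≡ₘ-setoid : Setoid _ _
  ≡ₘ-setoid = record { isEquivalence = ≡ₘ-isEquivalence }

  Bézout-in-ℤ : ∀ a b p q → 1 ℕ.+ a ℕ.* b ≡ p ℕ.* q → ℤ.1ℤ ℤ.+ + a ℤ.* + b ≡ + p ℤ.* + q
  Bézout-in-ℤ a b p q eq = begin
    ℤ.1ℤ ℤ.+ + a ℤ.* + b ≡⟨ cong (λ z → ℤ.1ℤ ℤ.+ z) (≡.sym (ℤP.pos-* a b)) ⟩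
    + (1 ℕ.+ a ℕ.* b)    ≡⟨ cong +_ eq ⟩
    + (p ℕ.* q)          ≡⟨ ℤP.pos-* p q ⟩
    + p ℤ.* + q          ∎
    where open ≡.≡-Reasoning

  inverse-ℕ : ∀ c → gcd n c ≡ 1 → ∃ λ f → + c ℤ.* f ≡ₘ ℤ.1ℤ
  inverse-ℕ c gcd≡1 with coprime-Bézout (gcd≡1⇒coprime gcd≡1)
  ... | Bézout.+- x y 1+yc≡xn = ℤ.- + y , (ℤ.- + x , equation)
    where
    open ≡.≡-Reasoning
    shift : ∀ c y → c ℤ.* ℤ.- y ≡ ℤ.1ℤ ℤ.- (ℤ.1ℤ ℤ.+ y ℤ.* c)
    shift = solve-∀
    negate : ∀ x n → ℤ.1ℤ ℤ.- x ℤ.* n ≡ ℤ.1ℤ ℤ.+ ℤ.- x ℤ.* n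
    negate = solve-∀
    equation : + c ℤ.* ℤ.- + y ≡ ℤ.1ℤ ℤ.+ ℤ.- + x ℤ.* + n
    equation = begin
      + c ℤ.* ℤ.- + y                 ≡⟨ shift (+ c) (+ y) ⟩
      ℤ.1ℤ ℤ.- (ℤ.1ℤ ℤ.+ + y ℤ.* + c) ≡⟨ cong (λ z → ℤ.1ℤ ℤ.- z) (Bézout-in-ℤ y c x n 1+yc≡xn) ⟩
      ℤ.1ℤ ℤ.- + x ℤ.* + n            ≡⟨ negate (+ x) (+ n) ⟩
      ℤ.1ℤ ℤ.+ ℤ.- + x ℤ.* + n        ∎
  ... | Bézout.-+ x y 1+xn≡yc =
    + y , (+ x , ≡.trans (ℤP.*-comm (+ c) (+ y)) (≡.sym (Bézout-in-ℤ x n y c 1+xn≡yc)))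

  inverse : ∀ z → ℤG.gcd (+ n) z ≡ + 1 → ∃ λ f → z ℤ.* f ≡ₘ ℤ.1ℤ
  inverse (+ c) gcd≡1 = inverse-ℕ c (ℤP.+-injective gcd≡1)
  inverse ℤ.-[1+ c ] gcd≡1 with inverse-ℕ (suc c) (ℤP.+-injective gcd≡1)
  ... | f , (k , eq) = ℤ.- f , (k , ≡.trans (neg-*-neg (+ suc c) f) eq)
    where
    neg-*-neg : ∀ a f → ℤ.- a ℤ.* ℤ.- f ≡ a ℤ.* f
    neg-*-neg = solve-∀

  unit-sym : ∀ D E → + D ℤ.* + E ≡ₘ + 1 → + E ℤ.* + D ≡ₘ + 1
  unit-sym D E = ≡.subst (_≡ₘ + 1) (ℤP.*-comm (+ D) (+ E))

  ≡ₘ-scale : ∀ {x a} → x ≡ₘ + a → ∀ j → x ℤ.* + j ≡ₘ + (a ℕ.* j)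
  ≡ₘ-scale {x} {a} x≡a j =
    ≡.subst (x ℤ.* + j ≡ₘ_) (≡.sym (ℤP.pos-* a j)) (≡ₘ-* x≡a (≡ₘ-refl {+ j}))

  module _ .{{_ : NonZero n}} where

    ≡ₘ-%ℕ : ∀ x → x ≡ₘ + (x ℤ.%ℕ n)
    ≡ₘ-%ℕ x = x ℤ./ℕ n , a≡a%ℕn+[a/ℕn]*n x n

    +multiple⇒%≡ : ∀ {a b} c → + a ≡ + b ℤ.+ + c ℤ.* + n → a % n ≡ b % n
    +multiple⇒%≡ {a} {b} c eq = ≡.trans (cong (_% n) a≡b+cn) ([m+kn]%n≡m%n b c n)
      where
      a≡b+cn : a ≡ b ℕ.+ c ℕ.* n
      a≡b+cn = ℤP.+-injective (≡.trans eq (cong (λ z → + b ℤ.+ z) (≡.sym (ℤP.pos-* c n))))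

    ≡ₘ⇒%≡ : ∀ {a b} → + a ≡ₘ + b → a % n ≡ b % n
    ≡ₘ⇒%≡ (+ c , eq) = +multiple⇒%≡ c eq
    ≡ₘ⇒%≡ a≡b@(ℤ.-[1+ c ] , _) =
      ≡.sym (+multiple⇒%≡ (suc c) (_≡ₘ_.equation (≡ₘ-sym a≡b)))

    unit-cancel : ∀ P Q → + P ℤ.* + Q ≡ₘ + 1 → ∀ i → (P ℕ.* ((Q ℕ.* i) % n)) % n ≡ i % n
    unit-cancel P Q PQ≡1 i = ≡ₘ⇒%≡ (begin
      + (P ℕ.* ((Q ℕ.* i) % n))  ≡⟨ ℤP.pos-* P _ ⟩
      + P ℤ.* + ((Q ℕ.* i) % n)  ≈⟨ ≡ₘ-* (≡ₘ-refl {+ P}) (≡ₘ-sym (≡ₘ-%ℕ (+ (Q ℕ.* i)))) ⟩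
      + P ℤ.* + (Q ℕ.* i)        ≡⟨ cong (λ z → + P ℤ.* z) (ℤP.pos-* Q i) ⟩
      + P ℤ.* (+ Q ℤ.* + i)      ≡⟨ ℤP.*-assoc (+ P) (+ Q) (+ i) ⟨
      (+ P ℤ.* + Q) ℤ.* + i      ≈⟨ ≡ₘ-* PQ≡1 (≡ₘ-refl {+ i}) ⟩
      + 1 ℤ.* + i                ≡⟨ ℤP.*-identityˡ (+ i) ⟩
      + i                        ∎)
      where open SetoidReasoning ≡ₘ-setoid

    unit-multiple-nonzero : ∀ D E → + D ℤ.* + E ≡ₘ + 1 →
                            ∀ j → 0 ℕ.< j → j ℕ.< n → ¬ ((D ℕ.* j) % n ≡ 0)
    unit-multiple-nonzero D E DE≡1 j 0<j j<n Dj%n≡0 = ℕP.<⇒≢ 0<j (≡.sym j≡0)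
      where
      open ≡.≡-Reasoning
      j≡0 : j ≡ 0
      j≡0 = begin
        j                           ≡⟨ m<n⇒m%n≡m j<n ⟨
        j % n                       ≡⟨ unit-cancel E D (unit-sym D E DE≡1) j ⟨
        (E ℕ.* ((D ℕ.* j) % n)) % n ≡⟨ cong (λ k → (E ℕ.* k) % n) Dj%n≡0 ⟩
        (E ℕ.* 0) % n               ≡⟨ cong (_% n) (ℕP.*-zeroʳ E) ⟩
        0 % n                       ≡⟨ m<n⇒m%n≡m (ℕ.>-nonZero⁻¹ n) ⟩
        0                           ∎

    scale : ℕ → Fin n → Fin n
    scale D i = fromℕ< (m%n<n (D ℕ.* toℕ i) n)

    toℕ-scale : ∀ D i → toℕ (scale D i) ≡ (D ℕ.* toℕ i) % n
    toℕ-scale D i = FinP.toℕ-fromℕ< _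

    scale-inverse : ∀ D E → + D ℤ.* + E ≡ₘ + 1 → ∀ i → scale D (scale E i) ≡ i
    scale-inverse D E DE≡1 i = FinP.toℕ-injective (begin
      toℕ (scale D (scale E i))       ≡⟨ toℕ-scale D _ ⟩
      (D ℕ.* toℕ (scale E i)) % n     ≡⟨ cong (λ k → (D ℕ.* k) % n) (toℕ-scale E i) ⟩
      (D ℕ.* ((E ℕ.* toℕ i) % n)) % n ≡⟨ unit-cancel D E DE≡1 (toℕ i) ⟩
      toℕ i % n                       ≡⟨ m<n⇒m%n≡m (FinP.toℕ<n i) ⟩
      toℕ i                           ∎)
      where open ≡.≡-Reasoning

    scale-permutation : ∀ D E → + D ℤ.* + E ≡ₘ + 1 → Permutation n n
    scale-permutation D E DE≡1 =
      permutation (scale D) (scale E) (scale-inverse D E DE≡1) (scale-inverse E D (unit-sym D E DE≡1))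

-- Triangular numbers and odd numbers

triangle : ℕ → ℕ
triangle zero    = 0
triangle (suc k) = triangle k ℕ.+ suc k

-- T(2k) = k (2k + 1): for odd n = 2k + 1, n divides T(n - 1).
triangle-even : ∀ k → triangle (k ℕ.* 2) ≡ k ℕ.* suc (k ℕ.* 2)
triangle-even zero    = ≡.refl
triangle-even (suc k) = begin
  triangle (k ℕ.* 2) ℕ.+ suc (k ℕ.* 2) ℕ.+ suc (suc (k ℕ.* 2))
    ≡⟨ cong (λ T → T ℕ.+ suc (k ℕ.* 2) ℕ.+ suc (suc (k ℕ.* 2))) (triangle-even k) ⟩
  k ℕ.* suc (k ℕ.* 2) ℕ.+ suc (k ℕ.* 2) ℕ.+ suc (suc (k ℕ.* 2))
    ≡⟨ identity k ⟩
  suc k ℕ.* suc (suc (suc (k ℕ.* 2))) ∎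
  where
  open ≡.≡-Reasoning
  identity : ∀ k → k ℕ.* suc (k ℕ.* 2) ℕ.+ suc (k ℕ.* 2) ℕ.+ suc (suc (k ℕ.* 2))
                   ≡ suc k ℕ.* suc (suc (suc (k ℕ.* 2)))
  identity = ℕSolver.solve-∀

odd⇒pred-even : ∀ m → suc m % 2 ≡ 1 → ∃ λ k → m ≡ k ℕ.* 2
odd⇒pred-even zero                _   = 0 , ≡.refl
odd⇒pred-even (suc zero)          ()
odd⇒pred-even (suc (suc m)) odd with odd⇒pred-even m (≡.trans (≡.sym m+2%2) odd)
  where
  m+2%2 : suc (suc (suc m)) % 2 ≡ suc m % 2
  m+2%2 = ≡.trans (cong (_% 2) (ℕP.+-comm 2 (suc m))) ([m+n]%n≡m%n (suc m) 2)
... | k , m≡2k = suc k , cong (λ l → suc (suc l)) m≡2k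

-- Products in a commutative ring and roots of unity

module RingFacts {c ℓ} (R : CommutativeRing c ℓ) where

  open CommutativeRing R
  open ExpProperties semiring using (_^_; ^-homo-*)
  open CommutativeSemigroupProperties *-commutativeSemigroup using (interchange)
  open RingProperties ring using (x[y-z]≈xy-xz)
  module ∏ = ProductProperties *-commutativeMonoid

  prod1-cong : ∀ {f h : ℕ → Carrier} k →
               (∀ j → 1 ℕ.≤ j → j ℕ.≤ k → f j ≈ h j) → prod1 R f k ≈ prod1 R h k
  prod1-cong zero    _   = refl
  prod1-cong (suc k) f≈h =
    *-cong (prod1-cong k (λ j 1≤j j≤k → f≈h j 1≤j (ℕP.m≤n⇒m≤1+n j≤k)))
           (f≈h (suc k) (ℕ.s≤s ℕ.z≤n) ℕP.≤-refl)

  prod1-* : ∀ (f h : ℕ → Carrier) k →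
            prod1 R (λ j → f j * h j) k ≈ prod1 R f k * prod1 R h k
  prod1-* f h zero    = sym (*-identityˡ 1#)
  prod1-* f h (suc k) = trans (*-congʳ (prod1-* f h k)) (interchange _ _ _ _)

  prod1-powers : ∀ x b k → prod1 R (λ j → x ^ (b ℕ.* j)) k ≈ x ^ (b ℕ.* triangle k)
  prod1-powers x b zero    = reflexive (cong (x ^_) (≡.sym (ℕP.*-zeroʳ b)))
  prod1-powers x b (suc k) = begin
    prod1 R (λ j → x ^ (b ℕ.* j)) k * x ^ (b ℕ.* suc k)  ≈⟨ *-congʳ (prod1-powers x b k) ⟩
    x ^ (b ℕ.* triangle k) * x ^ (b ℕ.* suc k)           ≈⟨ ^-homo-* x (b ℕ.* triangle k) (b ℕ.* suc k) ⟨
    x ^ (b ℕ.* triangle k ℕ.+ b ℕ.* suc k)               ≡⟨ cong (x ^_) (ℕP.*-distribˡ-+ b (triangle k) (suc k)) ⟨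
    x ^ (b ℕ.* triangle (suc k))                          ∎
    where open SetoidReasoning setoid

  prod1-shift : ∀ (h : ℕ → Carrier) k → prod1 R h (suc k) ≈ h 1 * prod1 R (λ j → h (suc j)) k
  prod1-shift h zero    = *-comm 1# (h 1)
  prod1-shift h (suc k) = trans (*-congʳ (prod1-shift h k)) (*-assoc _ _ _)

  prod1≈∏ : ∀ k (h : ℕ → Carrier) → prod1 R h k ≈ ∏.sum {k} (λ i → h (suc (toℕ i)))
  prod1≈∏ zero    h = refl
  prod1≈∏ (suc k) h = trans (prod1-shift h k) (*-congˡ (prod1≈∏ k (λ j → h (suc j))))

  ∏-residues : ∀ m (g : ℕ → Carrier) → g 0 ≈ 1# →
               ∏.sum {suc m} (λ i → g (toℕ i)) ≈ prod1 R g m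
  ∏-residues m g g0≈1 = trans (*-congʳ g0≈1) (trans (*-identityˡ _) (sym (prod1≈∏ m g)))

  prod1-reindex : ∀ m (g : ℕ → Carrier) → g 0 ≈ 1# →
                  ∀ D E → Congruence._≡ₘ_ (suc m) (+ D ℤ.* + E) (+ 1) →
                  prod1 R (λ j → g ((D ℕ.* j) % suc m)) m ≈ prod1 R g m
  prod1-reindex m g g0≈1 D E DE≡1 = begin
    prod1 R (λ j → g ((D ℕ.* j) % suc m)) m
      ≈⟨ ∏-residues m (λ j → g ((D ℕ.* j) % suc m)) gD0≈1 ⟨
    ∏.sum {suc m} (λ i → g ((D ℕ.* toℕ i) % suc m))
      ≡⟨ ∏.sum-cong-≗ {suc m} (λ i → cong g (toℕ-scale D i)) ⟨
    ∏.sum {suc m} (λ i → g (toℕ (scale D i)))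
      ≈⟨ ∏.sum-permute (λ i → g (toℕ i)) (scale-permutation D E DE≡1) ⟨
    ∏.sum {suc m} (λ i → g (toℕ i))
      ≈⟨ ∏-residues m g g0≈1 ⟩
    prod1 R g m ∎
    where
    open Congruence (suc m)
    open SetoidReasoning setoid
    gD0≈1 : g ((D ℕ.* 0) % suc m) ≈ 1#
    gD0≈1 = trans (reflexive (cong (λ k → g (k % suc m)) (ℕP.*-zeroʳ D))) g0≈1

  -- 1 - u^k, with the factor at k = 0 set to 1 so that it is neutral in a
  -- product over all residues.
  oneMinusPow : Carrier → ℕ → Carrier
  oneMinusPow u zero    = 1#
  oneMinusPow u (suc k) = 1# - u ^ suc k

  module RootOfUnity (m : ℕ) (u : Carrier) (uⁿ≈1 : u ^ suc m ≈ 1#) where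

    n : ℕ
    n = suc m

    open Congruence n
    open SetoidReasoning setoid

    ^-multiple : ∀ q → u ^ (q ℕ.* n) ≈ 1#
    ^-multiple zero    = refl
    ^-multiple (suc q) = begin
      u ^ (n ℕ.+ q ℕ.* n)    ≈⟨ ^-homo-* u n (q ℕ.* n) ⟩
      u ^ n * u ^ (q ℕ.* n)  ≈⟨ *-cong uⁿ≈1 (^-multiple q) ⟩
      1# * 1#                ≈⟨ *-identityˡ 1# ⟩
      1#                     ∎

    ^-% : ∀ a → u ^ a ≈ u ^ (a % n)
    ^-% a = begin
      u ^ a                              ≡⟨ cong (u ^_) (m≡m%n+[m/n]*n a n) ⟩
      u ^ (a % n ℕ.+ (a / n) ℕ.* n)      ≈⟨ ^-homo-* u (a % n) ((a / n) ℕ.* n) ⟩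
      u ^ (a % n) * u ^ ((a / n) ℕ.* n)  ≈⟨ *-congˡ (^-multiple (a / n)) ⟩
      u ^ (a % n) * 1#                   ≈⟨ *-identityʳ _ ⟩
      u ^ (a % n)                        ∎

    powℤ-≡ₘ : ∀ {x a} → x ≡ₘ + a → powℤ R n u x ≈ u ^ a
    powℤ-≡ₘ {x} {a} x≡a = begin
      u ^ (x ℤ.%ℕ n)      ≈⟨ ^-% (x ℤ.%ℕ n) ⟩
      u ^ (x ℤ.%ℕ n % n)  ≡⟨ cong (u ^_) (≡ₘ⇒%≡ (≡ₘ-trans (≡ₘ-sym (≡ₘ-%ℕ x)) x≡a)) ⟩
      u ^ (a % n)         ≈⟨ ^-% a ⟨
      u ^ a               ∎

    1-^≈oneMinusPow : ∀ a → ¬ (a % n ≡ 0) → 1# - u ^ a ≈ oneMinusPow u (a % n)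
    1-^≈oneMinusPow a a%n≢0 with a % n in a%n≡
    ... | zero  = contradiction ≡.refl a%n≢0
    ... | suc k = +-congˡ (-‿cong (trans (^-% a) (reflexive (cong (u ^_) a%n≡))))

    -- λ_j = u^{Bj} (1 - u^{Dj}) whenever n - r ≡ B and r - t ≡ D mod n,
    -- because n - t = (n - r) + (r - t).
    lam-factorisation : ∀ r t B D → + n ℤ.- r ≡ₘ + B → r ℤ.- t ≡ₘ + D →
                        ∀ j → lam R n u r t j ≈ u ^ (B ℕ.* j) * (1# - u ^ (D ℕ.* j))
    lam-factorisation r t B D n-r≡B r-t≡D j = begin
      powℤ R n u ((+ n ℤ.- r) ℤ.* + j) - powℤ R n u ((+ n ℤ.- t) ℤ.* + j)
        ≈⟨ +-cong (powℤ-≡ₘ (≡ₘ-scale n-r≡B j)) (-‿cong (powℤ-≡ₘ (≡ₘ-scale n-t≡B+D j))) ⟩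
      u ^ (B ℕ.* j) - u ^ ((B ℕ.+ D) ℕ.* j)
        ≡⟨ cong (λ e → u ^ (B ℕ.* j) - u ^ e) (ℕP.*-distribʳ-+ j B D) ⟩
      u ^ (B ℕ.* j) - u ^ (B ℕ.* j ℕ.+ D ℕ.* j)
        ≈⟨ +-cong (sym (*-identityʳ _)) (-‿cong (^-homo-* u (B ℕ.* j) (D ℕ.* j))) ⟩
      u ^ (B ℕ.* j) * 1# - u ^ (B ℕ.* j) * u ^ (D ℕ.* j)
        ≈⟨ x[y-z]≈xy-xz _ _ _ ⟨
      u ^ (B ℕ.* j) * (1# - u ^ (D ℕ.* j)) ∎
      where
      split : ∀ n r t → (n ℤ.- r) ℤ.+ (r ℤ.- t) ≡ n ℤ.- t
      split = solve-∀
      n-t≡B+D : + n ℤ.- t ≡ₘ + (B ℕ.+ D)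
      n-t≡B+D = ≡.subst₂ _≡ₘ_ (split (+ n) r t) (≡.sym (ℤP.pos-+ B D)) (≡ₘ-+ n-r≡B r-t≡D)

    -- For odd n, ∏_{j=1}^{n-1} u^{bj} = u^{b T(n-1)} = 1, as n divides T(n-1).
    prod1-powers≈1 : suc m % 2 ≡ 1 → ∀ b → prod1 R (λ j → u ^ (b ℕ.* j)) m ≈ 1#
    prod1-powers≈1 n-odd b with odd⇒pred-even m n-odd
    ... | k , m≡2k = begin
      prod1 R (λ j → u ^ (b ℕ.* j)) m  ≈⟨ prod1-powers u b m ⟩
      u ^ (b ℕ.* triangle m)           ≡⟨ cong (λ e → u ^ (b ℕ.* e)) triangle-m ⟩
      u ^ (b ℕ.* (k ℕ.* n))            ≡⟨ cong (u ^_) (ℕP.*-assoc b k n) ⟨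
      u ^ (b ℕ.* k ℕ.* n)              ≈⟨ ^-multiple (b ℕ.* k) ⟩
      1#                               ∎
      where
      triangle-m : triangle m ≡ k ℕ.* n
      triangle-m = ≡.trans (cong triangle m≡2k)
                     (≡.trans (triangle-even k) (cong (λ l → k ℕ.* suc l) (≡.sym m≡2k)))

  lam-product : ∀ m → suc m % 2 ≡ 1 → ∀ u → u ^ suc m ≈ 1# →
                ∀ r t → ℤG.gcd (+ suc m) (r ℤ.- t) ≡ + 1 →
                prod1 R (lam R (suc m) u r t) m ≈ prod1 R (oneMinusPow u) m
  lam-product m n-odd u uⁿ≈1 r t coprime = begin
    prod1 R (lam R n u r t) m
      ≈⟨ prod1-cong m (λ j _ _ → lam-factorisation r t B D (≡ₘ-%ℕ _) (≡ₘ-%ℕ _) j) ⟩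
    prod1 R (λ j → u ^ (B ℕ.* j) * (1# - u ^ (D ℕ.* j))) m
      ≈⟨ prod1-* _ _ m ⟩
    prod1 R (λ j → u ^ (B ℕ.* j)) m * prod1 R (λ j → 1# - u ^ (D ℕ.* j)) m
      ≈⟨ *-cong (prod1-powers≈1 n-odd B) (prod1-cong m nonzero-residue) ⟩
    1# * prod1 R (λ j → oneMinusPow u ((D ℕ.* j) % n)) m
      ≈⟨ *-identityˡ _ ⟩
    prod1 R (λ j → oneMinusPow u ((D ℕ.* j) % n)) m
      ≈⟨ prod1-reindex m (oneMinusPow u) refl D E DE≡1 ⟩
    prod1 R (oneMinusPow u) m ∎
    where
    open RootOfUnity m u uⁿ≈1
    open Congruence n
    open SetoidReasoning setoid

    r-t-invertible : ∃ λ f → (r ℤ.- t) ℤ.* f ≡ₘ ℤ.1ℤ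
    r-t-invertible = inverse (r ℤ.- t) coprime

    B D E : ℕ
    B = (+ n ℤ.- r) ℤ.%ℕ n
    D = (r ℤ.- t) ℤ.%ℕ n
    E = proj₁ r-t-invertible ℤ.%ℕ n

    DE≡1 : + D ℤ.* + E ≡ₘ + 1
    DE≡1 = ≡ₘ-trans (≡ₘ-* (≡ₘ-sym (≡ₘ-%ℕ (r ℤ.- t))) (≡ₘ-sym (≡ₘ-%ℕ (proj₁ r-t-invertible))))
                    (proj₂ r-t-invertible)

    nonzero-residue : ∀ j → 1 ℕ.≤ j → j ℕ.≤ m →
                      1# - u ^ (D ℕ.* j) ≈ oneMinusPow u ((D ℕ.* j) % n)
    nonzero-residue j 1≤j j≤m =
      1-^≈oneMinusPow (D ℕ.* j) (unit-multiple-nonzero D E DE≡1 j 1≤j (ℕ.s≤s j≤m))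

lemma3 : ∀ {c ℓ} (R : CommutativeRing c ℓ) → IsField R →
         (p : ℕ) → Prime p → p % 2 ≡ 1 → HasCharacteristic R p →
         (n : ℕ) .{{_ : NonZero n}} → n % 2 ≡ 1 → gcd n p ≡ 1 →
         (u : CommutativeRing.Carrier R) → IsPrimitiveRoot R n u →
         (r t v w : ℤ) →
         ℤG.gcd (+ n) (r ℤ.+ t) ≡ + 1 → ℤG.gcd (+ n) (r ℤ.- t) ≡ + 1 →
         ℤG.gcd (+ n) (v ℤ.+ w) ≡ + 1 → ℤG.gcd (+ n) (v ℤ.- w) ≡ + 1 →
         CommutativeRing._≈_ R
           (prod1 R (lam R n u r t) (n ∸ 1))
           (prod1 R (lam R n u v w) (n ∸ 1))
lemma3 R _ _ _ _ _ (suc m) n-odd _ u u-primitive r t v w _ r-t-coprime _ v-w-coprime =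
  trans (lam-product m n-odd u (pow-n≈1 u-primitive) r t r-t-coprime)
        (sym (lam-product m n-odd u (pow-n≈1 u-primitive) v w v-w-coprime))
  where
  open CommutativeRing R using (trans; sym)
  open RingFacts R using (lam-product)
  open IsPrimitiveRoot using (pow-n≈1)
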